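{- Let $\mathcal R=(R,\oplus,\le,0)$ be a distance magma and $S\subseteq R$ with $0\in S$. Then $\mathcal S^*=(S^*,\oplus^*,\le^*,0)$ is a difference-complete distance magma; that is, it is a distance magma and for all $\alpha,\beta\in S^*$ the set $\{x\in S^*:\alpha\le^*\beta\oplus^* x\text{ and }\beta\le^*\alpha\oplus^* x\}$ has a minimum.
   Context: A distance magma is a structure $(R,\oplus,\le,0)$ with $\oplus$ binary, $0\in R$, such that $\le$ is a total order, $r\le r\oplus s$, $r\le t,s\le u\Rightarrow r\oplus s\le t\oplus u$, $\oplus$ commutative, $0$ an identity. A distance magma is difference-complete if for all $r,s$ the set $\{x: r\le s\oplus x\text{ and } s\le r\oplus x\}$ has a minimal element. $\mathcal S^*$: $\mathcal L_S$ has binary relation symbols $d(x,y)\le s$ ($s\in S$). $T_{\mathrm{MS}}(S,\mathcal R)$ is: $\forall x\forall y(d(x,y)\le0\leftrightarrow x=y)$; $\forall x\forall y(d(x,y)\le s\leftrightarrow d(y,x)\le s)$ for $s\in S$; for $r,s,t\in S$ with no $x\in S$ satisfying $t<x\le r\oplus s$, $\forall x\forall y\forall z((d(x,y)\le r\wedge d(y,z)\le s)\to d(x,z)\le t)$; if $S$ has a maximum $s$, $\forall x\forall y\,d(x,y)\le s$. A cut in $S$ is an upward-closed $X\subseteq S$ containing $\max S$ if it exists; $S^*$ is the set of cuts ordered by $X\le^*Y\iff Y\subseteq X$ (a complete linear order), with $r\in S$ identified with $\{x\in S:x\ge r\}$. For $\alpha\in S^*$, $p_\alpha(x,y)=\{d(x,y)\le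 s:\alpha\le^* s\}\cup\{\neg d(x,y)\le s:s<^*\alpha\}$ ($s\in S$). $\alpha\oplus^*\beta$ is the supremum of the set of $\gamma\in S^*$ for which $T_{\mathrm{MS}}(S,\mathcal R)\cup p_\alpha(x,y)\cup p_\beta(y,z)\cup p_\gamma(x,z)$ is consistent. -}

module Defs where

open import Level using (Level; _⊔_) renaming (suc to lsuc)
open import Data.Product using (Σ; Σ-syntax; _×_; _,_; proj₁)
open import Relation.Nullary using (¬_)
open import Relation.Unary using (Pred)
open import Relation.Binary using (Rel; IsTotalOrder)
open import Relation.Binary.PropositionalEquality using (_≡_; _≢_)

record IsDistanceMagma {a e r} {A : Set a} (_≈_ : Rel A e) (_≤_ : Rel A r)
                       (_⊕_ : A → A → A) (𝟘 : A) : Set (a ⊔ e ⊔ r) where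
  field
    isTotalOrder : IsTotalOrder _≈_ _≤_
    ⊕-cong       : ∀ {x y u v} → x ≈ y → u ≈ v → (x ⊕ u) ≈ (y ⊕ v)
    extensive    : ∀ x y → x ≤ (x ⊕ y)
    monotone     : ∀ {x s t u} → x ≤ t → s ≤ u → (x ⊕ s) ≤ (t ⊕ u)
    comm         : ∀ x y → (x ⊕ y) ≈ (y ⊕ x)
    identityˡ    : ∀ x → (𝟘 ⊕ x) ≈ x
    identityʳ    : ∀ x → (x ⊕ 𝟘) ≈ x

DiffSet : ∀ {a r} {A : Set a} (_≤_ : Rel A r) (_⊕_ : A → A → A) → A → A → A → Set r
DiffSet _≤_ _⊕_ x y z = (x ≤ (y ⊕ z)) × (y ≤ (x ⊕ z))

record IsDifferenceCompleteDistanceMagma {a e r} {A : Set a} (_≈_ : Rel A e)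
         (_≤_ : Rel A r) (_⊕_ : A → A → A) (𝟘 : A) : Set (a ⊔ e ⊔ r) where
  field
    isDistanceMagma : IsDistanceMagma _≈_ _≤_ _⊕_ 𝟘
    diffMin : ∀ x y → Σ[ m ∈ A ] (DiffSet _≤_ _⊕_ x y m
                                 × (∀ z → DiffSet _≤_ _⊕_ x y z → m ≤ z))

module Construction {ℓ} (R : Set ℓ) (_⊕_ : R → R → R) (_≤_ : Rel R ℓ) (𝟘 : R)
                    (S : Pred R ℓ) (𝟘∈S : S 𝟘) where

  El : Set ℓ
  El = Σ R S

  val : El → R
  val = proj₁

  0S : El
  0S = 𝟘 , 𝟘∈S

  _<_ : R → R → Set ℓ
  x < y = (x ≤ y) × (x ≢ y)

  IsMaxS : El → Set ℓ
  IsMaxS m = ∀ y → val y ≤ val m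

  record Cut : Set (lsuc ℓ) where
    field
      mem    : El → Set ℓ
      upward : ∀ x y → val x ≤ val y → mem x → mem y
      hasMax : ∀ m → IsMaxS m → mem m
  open Cut public

  _≤*_ : Cut → Cut → Set ℓ
  X ≤* Y = ∀ s → mem Y s → mem X s

  _≈*_ : Cut → Cut → Set ℓ
  X ≈* Y = (X ≤* Y) × (Y ≤* X)

  module _ (≤-trans : ∀ {x y z} → x ≤ y → y ≤ z → x ≤ z) where

    ι : El → Cut
    ι s = record { mem = λ x → val s ≤ val x
                 ; upward = λ x y x≤y s≤x → ≤-trans s≤x x≤y
                 ; hasMax = λ m isMax → isMax s }

    0* : Cut
    0* = ι 0S

    _<*_ : Cut → Cut → Set ℓ
    X <* Y = ¬ (Y ≤* X)

    -- L_S-structures: a carrier M with, for each s ∈ S, a binary relation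
    -- D a b s  meaning  "d(a,b) ≤ s".
    -- Models of T_MS(S, R):
    record IsModel (M : Set ℓ) (D : M → M → El → Set ℓ) : Set (lsuc ℓ) where
      field
        zeroAx : ∀ a b → (D a b 0S → a ≡ b) × (a ≡ b → D a b 0S)
        symAx  : ∀ a b s → (D a b s → D b a s) × (D b a s → D a b s)
        triAx  : ∀ r s t → ¬ (Σ[ x ∈ El ] ((val t < val x) × (val x ≤ (val r ⊕ val s))))
                 → ∀ a b c → D a b r → D b c s → D a c t
        maxAx  : ∀ m → IsMaxS m → ∀ a b → D a b m

    Realises : {M : Set ℓ} → (M → M → El → Set ℓ) → Cut → M → M → Set ℓ
    Realises D α a b = ∀ s → ((α ≤* ι s) → D a b s) × ((ι s <* α) → ¬ D a b s)

    -- T_MS ∪ p_α(x,y) ∪ p_β(y,z) ∪ p_γ(x,z) is consistent (has a model)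
    Consistent : Cut → Cut → Cut → Set (lsuc ℓ)
    Consistent α β γ =
      Σ[ M ∈ Set ℓ ] Σ[ D ∈ (M → M → El → Set ℓ) ] (IsModel M D ×
        Σ[ x ∈ M ] Σ[ y ∈ M ] Σ[ z ∈ M ]
          (Realises D α x y × Realises D β y z × Realises D γ x z))

    IsSup* : (Cut → Set (lsuc ℓ)) → Cut → Set (lsuc ℓ)
    IsSup* U σ = (∀ γ → U γ → γ ≤* σ)
               × (∀ τ → (∀ γ → U γ → γ ≤* τ) → σ ≤* τ)

    IsOplus* : (Cut → Cut → Cut) → Set (lsuc ℓ)
    IsOplus* op = ∀ α β → IsSup* (Consistent α β) (op α β)

IsTotalOrderTrans : ∀ {a e r} {A : Set a} {_≈_ : Rel A e} {_≤_ : Rel A r} →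
                    IsTotalOrder _≈_ _≤_ → ∀ {x y z} → x ≤ y → y ≤ z → x ≤ z
IsTotalOrderTrans t = IsTotalOrder.trans t

-- The sum α ⊕* β is the explicit cut α ⊞ β of all t ∈ S for which some r ∈ α and s ∈ β leave no
-- element of S in the interval (t, r ⊕ s]. It bounds every consistent γ, because the triangle axiom
-- of T_MS forces d(x,z) ≤ t for each such t. It is itself consistent: when neither α nor β contains 0
-- it is realised by the three-point space with sides α, β, α ⊞ β, and otherwise the points at
-- distance 0 are merged. So ⊕* agrees with ⊞ up to equality of cuts, and the distance-magma laws are
-- checked for ⊞. The minimal difference of α and β is the cut of those s whose principal cut lies in
-- the difference set; it lies there itself, because β ⊞ γ is the union of the sums β ⊞ ↑ s, s ∈ γ.

module Submission where

open import Defs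
open import Level using (lift; lower) renaming (suc to lsuc)
open import Data.Product using (Σ-syntax; _×_; _,_; proj₁; proj₂)
open import Data.Sum using (_⊎_; inj₁; inj₂)
open import Data.Empty using (⊥-elim)
open import Data.Unit.Polymorphic using (⊤)
open import Relation.Nullary using (¬_; yes; no)
open import Relation.Nullary.Decidable using (map′)
open import Relation.Unary using (Pred)
open import Relation.Binary using (Rel; IsTotalOrder)
open import Relation.Binary.PropositionalEquality using (_≡_; refl; sym; subst)
open import Axiom.ExcludedMiddle using (ExcludedMiddle)
open import Axiom.DoubleNegationElimination using (em⇒dne)

lower-em : ∀ {ℓ} → ExcludedMiddle (lsuc ℓ) → ExcludedMiddle ℓ
lower-em em = map′ lower lift em

module _ {a e r} {A : Set a} {_≈_ : Rel A e} {_≤_ : Rel A r} {_⊕_ _⊕′_ : A → A → A} {𝟘 : A}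
         (⊕≈⊕′ : ∀ x y → (x ⊕ y) ≈ (x ⊕′ y)) where

  isDifferenceCompleteDistanceMagma-resp :
    IsDifferenceCompleteDistanceMagma _≈_ _≤_ _⊕_ 𝟘 →
    IsDifferenceCompleteDistanceMagma _≈_ _≤_ _⊕′_ 𝟘
  isDifferenceCompleteDistanceMagma-resp dc = record
    { isDistanceMagma = record
      { isTotalOrder = isTotalOrder
      ; ⊕-cong       = λ x≈y u≈v → Eq.trans (Eq.sym (⊕≈⊕′ _ _)) (Eq.trans (⊕-cong x≈y u≈v) (⊕≈⊕′ _ _))
      ; extensive    = λ x y → ≤-respʳ-≈ (⊕≈⊕′ x y) (extensive x y)
      ; monotone     = λ x≤t s≤u → ≤-respˡ-≈ (⊕≈⊕′ _ _) (≤-respʳ-≈ (⊕≈⊕′ _ _) (monotone x≤t s≤u))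
      ; comm         = λ x y → Eq.trans (Eq.sym (⊕≈⊕′ x y)) (Eq.trans (comm x y) (⊕≈⊕′ y x))
      ; identityˡ    = λ x → Eq.trans (Eq.sym (⊕≈⊕′ 𝟘 x)) (identityˡ x)
      ; identityʳ    = λ x → Eq.trans (Eq.sym (⊕≈⊕′ x 𝟘)) (identityʳ x)
      }
    ; diffMin = λ x y → let (m , m∈ , m-min) = diffMin x y
                        in m , to m∈ , λ z z∈ → m-min z (from z∈)
    }
    where
      open IsDifferenceCompleteDistanceMagma dc
      open IsDistanceMagma isDistanceMagma
      open IsTotalOrder isTotalOrder using (module Eq; ≤-respˡ-≈; ≤-respʳ-≈)

      to : ∀ {x y z} → DiffSet _≤_ _⊕_ x y z → DiffSet _≤_ _⊕′_ x y z
      to (x≤ , y≤) = ≤-respʳ-≈ (⊕≈⊕′ _ _) x≤ , ≤-respʳ-≈ (⊕≈⊕′ _ _) y≤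

      from : ∀ {x y z} → DiffSet _≤_ _⊕′_ x y z → DiffSet _≤_ _⊕_ x y z
      from (x≤ , y≤) = ≤-respʳ-≈ (Eq.sym (⊕≈⊕′ _ _)) x≤ , ≤-respʳ-≈ (Eq.sym (⊕≈⊕′ _ _)) y≤

module CutMagma {ℓ} (em : ExcludedMiddle ℓ)
    (R : Set ℓ) (_⊕_ : R → R → R) (_≤_ : Rel R ℓ) (𝟘 : R)
    (isDM : IsDistanceMagma _≡_ _≤_ _⊕_ 𝟘)
    (S : Pred R ℓ) (𝟘∈S : S 𝟘) where

  open Construction R _⊕_ _≤_ 𝟘 S 𝟘∈S
  open IsDistanceMagma isDM
  open IsTotalOrder isTotalOrder using (total; antisym; reflexive)

  ≤-trans : ∀ {x y z} → x ≤ y → y ≤ z → x ≤ z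
  ≤-trans = IsTotalOrderTrans isTotalOrder

  ≤-refl : ∀ {x} → x ≤ x
  ≤-refl = reflexive refl

  dne : {P : Set ℓ} → ¬ ¬ P → P
  dne = em⇒dne em

  𝟘≤ : ∀ x → 𝟘 ≤ x
  𝟘≤ x = subst (𝟘 ≤_) (identityˡ x) (extensive 𝟘 x)

  infix 40 ↑_

  ↑_ : El → Cut
  ↑_ = ι ≤-trans

  𝟘* : Cut
  𝟘* = 0* ≤-trans

  -- S meets the interval (t, u] nowhere; this is the side condition of the triangle axiom.
  NoSIn⟨_,_] : R → R → Set ℓ
  NoSIn⟨ t , u ] = ¬ (Σ[ x ∈ El ] ((t < val x) × (val x ≤ u)))

  NoSIn-refl : ∀ u → NoSIn⟨ u , u ]
  NoSIn-refl u (x , (u≤x , u≢x) , x≤u) = u≢x (antisym u≤x x≤u)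

  NoSIn-monoˡ : ∀ {t t′ u} → t ≤ t′ → NoSIn⟨ t , u ] → NoSIn⟨ t′ , u ]
  NoSIn-monoˡ t≤t′ empty (x , (t′≤x , t′≢x) , x≤u) =
    empty (x , (≤-trans t≤t′ t′≤x , λ t≡x → t′≢x (antisym t′≤x (subst (_≤ _) t≡x t≤t′))) , x≤u)

  NoSIn-max : ∀ {u} m → IsMaxS m → NoSIn⟨ val m , u ]
  NoSIn-max m isMax (x , (m≤x , m≢x) , _) = m≢x (antisym m≤x (isMax x))

  ≤-NoSIn : ∀ {t u} (r : El) → NoSIn⟨ t , u ] → val r ≤ u → val r ≤ t
  ≤-NoSIn {t} r empty r≤u with total (val r) t
  ... | inj₁ r≤t = r≤t
  ... | inj₂ t≤r = dne λ r≰t → empty (r , (t≤r , λ t≡r → r≰t (reflexive (sym t≡r))) , r≤u)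

  ≤*-refl : ∀ {X} → X ≤* X
  ≤*-refl _ s∈X = s∈X

  ≤*-trans : ∀ {X Y Z} → X ≤* Y → Y ≤* Z → X ≤* Z
  ≤*-trans X≤Y Y≤Z s s∈Z = X≤Y s (Y≤Z s s∈Z)

  ≈*-refl : ∀ {X} → X ≈* X
  ≈*-refl {X} = ≤*-refl {X} , ≤*-refl {X}

  ≤*-total : ∀ X Y → (X ≤* Y) ⊎ (Y ≤* X)
  ≤*-total X Y with em {Σ[ s ∈ El ] (mem Y s × ¬ mem X s)}
  ... | no Y⊆X = inj₁ λ s s∈Y → dne λ s∉X → Y⊆X (s , s∈Y , s∉X)
  ... | yes (s , s∈Y , s∉X) = inj₂ X⊆Y
    where
      X⊆Y : Y ≤* X
      X⊆Y s′ s′∈X with total (val s) (val s′)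
      ... | inj₁ s≤s′ = upward Y s s′ s≤s′ s∈Y
      ... | inj₂ s′≤s = ⊥-elim (s∉X (upward X s′ s s′≤s s′∈X))

  ≤*-isTotalOrder : IsTotalOrder _≈*_ _≤*_
  ≤*-isTotalOrder = record
    { isPartialOrder = record
      { isPreorder = record
        { isEquivalence = record
          { refl  = λ {X} → ≈*-refl {X}
          ; sym   = λ (X≤Y , Y≤X) → Y≤X , X≤Y
          ; trans = λ {X} {Y} {Z} (X≤Y , Y≤X) (Y≤Z , Z≤Y) →
                      ≤*-trans {X} {Y} {Z} X≤Y Y≤Z , ≤*-trans {Z} {Y} {X} Z≤Y Y≤X
          }
        ; reflexive = proj₁
        ; trans     = λ {X} {Y} {Z} → ≤*-trans {X} {Y} {Z}
        }
      ; antisym = _,_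
      }
    ; total = ≤*-total
    }

  𝟘*-minimum : ∀ X → 𝟘* ≤* X
  𝟘*-minimum X s _ = 𝟘≤ (val s)

  ∈⇒≤*↑ : ∀ X {s} → mem X s → X ≤* ↑ s
  ∈⇒≤*↑ X {s} s∈X t s≤t = upward X s t s≤t s∈X

  𝟘∈⇒≈𝟘* : ∀ X → mem X 0S → 𝟘* ≈* X
  𝟘∈⇒≈𝟘* X 𝟘∈X = 𝟘*-minimum X , ∈⇒≤*↑ X 𝟘∈X

  infixl 30 _⊞_

  _⊞_ : Cut → Cut → Cut
  A ⊞ B = record
    { mem    = λ t → Σ[ r ∈ El ] Σ[ s ∈ El ] (mem A r × mem B s × NoSIn⟨ val t , val r ⊕ val s ])
    ; upward = λ t t′ t≤t′ (r , s , r∈A , s∈B , empty) → r , s , r∈A , s∈B , NoSIn-monoˡ t≤t′ empty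
    ; hasMax = λ m isMax → m , m , hasMax A m isMax , hasMax B m isMax , NoSIn-max m isMax
    }

  x≤*x⊞y : ∀ A B → A ≤* A ⊞ B
  x≤*x⊞y A B t (r , s , r∈A , _ , empty) =
    upward A r t (≤-NoSIn r empty (extensive (val r) (val s))) r∈A

  y≤*x⊞y : ∀ A B → B ≤* A ⊞ B
  y≤*x⊞y A B t (r , s , _ , s∈B , empty) =
    upward B s t (≤-NoSIn s empty s≤r⊕s) s∈B
    where
      s≤r⊕s : val s ≤ (val r ⊕ val s)
      s≤r⊕s = subst (val s ≤_) (comm (val s) (val r)) (extensive (val s) (val r))

  ⊞-mono : ∀ {A B A′ B′} → A ≤* A′ → B ≤* B′ → A ⊞ B ≤* A′ ⊞ B′
  ⊞-mono A≤A′ B≤B′ t (r , s , r∈A′ , s∈B′ , empty) = r , s , A≤A′ r r∈A′ , B≤B′ s s∈B′ , empty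

  ⊞-comm : ∀ A B → A ⊞ B ≤* B ⊞ A
  ⊞-comm A B t (r , s , r∈B , s∈A , empty) =
    s , r , s∈A , r∈B , subst (λ u → NoSIn⟨ val t , u ]) (comm (val r) (val s)) empty

  ⊞-identityˡ : ∀ A B → mem A 0S → A ⊞ B ≤* B
  ⊞-identityˡ A B 𝟘∈A t t∈B =
    0S , t , 𝟘∈A , t∈B , subst (λ u → NoSIn⟨ val t , u ]) (sym (identityˡ (val t))) (NoSIn-refl (val t))

  ⊞-identityʳ : ∀ A B → mem B 0S → A ⊞ B ≤* A
  ⊞-identityʳ A B 𝟘∈B t t∈A =
    t , 0S , t∈A , 𝟘∈B , subst (λ u → NoSIn⟨ val t , u ]) (sym (identityʳ (val t))) (NoSIn-refl (val t))

  ≤*⊞↑-max : ∀ m → IsMaxS m → ∀ A B → A ≤* B ⊞ ↑ m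
  ≤*⊞↑-max m isMax A B = ≤*-trans {A} {↑ m} {B ⊞ ↑ m} (∈⇒≤*↑ A (hasMax A m isMax)) (y≤*x⊞y B (↑ m))

  record CutMetric (M : Set ℓ) : Set (lsuc ℓ) where
    field
      δ      : M → M → Cut
      δ-sym  : ∀ a b → δ b a ≤* δ a b
      δ-refl : ∀ a → mem (δ a a) 0S
      δ-zero : ∀ a b → mem (δ a b) 0S → a ≡ b
      δ-tri  : ∀ a b c → δ a c ≤* δ a b ⊞ δ b c

    isModel : IsModel ≤-trans M (λ a b → mem (δ a b))
    isModel = record
      { zeroAx = λ a b → δ-zero a b , λ { refl → δ-refl a }
      ; symAx  = λ a b s → δ-sym a b s , δ-sym b a s
      ; triAx  = λ r s t empty a b c r∈ s∈ → δ-tri a b c t (r , s , r∈ , s∈ , empty)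
      ; maxAx  = λ m isMax a b → hasMax (δ a b) m isMax
      }

    realises : ∀ a b {γ} → δ a b ≈* γ → Realises ≤-trans (λ a b → mem (δ a b)) γ a b
    realises a b {γ} (δ≤γ , γ≤δ) s =
      (λ γ≤↑s → δ≤γ s (γ≤↑s s ≤-refl)) , λ ↑s<γ s∈δ → ↑s<γ (∈⇒≤*↑ γ (γ≤δ s s∈δ))

    consistent : ∀ {α β γ} x y z → δ x y ≈* α → δ y z ≈* β → δ x z ≈* γ → Consistent ≤-trans α β γ
    consistent {α} {β} {γ} x y z xy yz xz =
      M , (λ a b → mem (δ a b)) , isModel , x , y , z ,
      realises x y {α} xy , realises y z {β} yz , realises x z {γ} xz

  data Three : Set ℓ where
    px py pz : Three

  triangle : (α β : Cut) → ¬ mem α 0S → ¬ mem β 0S → CutMetric Three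
  triangle α β 𝟘∉α 𝟘∉β = record { δ = δ ; δ-sym = δ-sym ; δ-refl = δ-refl ; δ-zero = δ-zero ; δ-tri = δ-tri }
    where
      σ : Cut
      σ = α ⊞ β

      𝟘∉σ : ¬ mem σ 0S
      𝟘∉σ 𝟘∈σ = 𝟘∉α (x≤*x⊞y α β 0S 𝟘∈σ)

      δ : Three → Three → Cut
      δ px px = 𝟘*
      δ py py = 𝟘*
      δ pz pz = 𝟘*
      δ px py = α
      δ py px = α
      δ py pz = β
      δ pz py = β
      δ px pz = σ
      δ pz px = σ

      δ-sym : ∀ a b → δ b a ≤* δ a b
      δ-sym px px = ≤*-refl {𝟘*}
      δ-sym py py = ≤*-refl {𝟘*}
      δ-sym pz pz = ≤*-refl {𝟘*}
      δ-sym px py = ≤*-refl {α}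
      δ-sym py px = ≤*-refl {α}
      δ-sym py pz = ≤*-refl {β}
      δ-sym pz py = ≤*-refl {β}
      δ-sym px pz = ≤*-refl {σ}
      δ-sym pz px = ≤*-refl {σ}

      δ-refl : ∀ a → mem (δ a a) 0S
      δ-refl px = ≤-refl
      δ-refl py = ≤-refl
      δ-refl pz = ≤-refl

      δ-zero : ∀ a b → mem (δ a b) 0S → a ≡ b
      δ-zero px px _ = refl
      δ-zero py py _ = refl
      δ-zero pz pz _ = refl
      δ-zero px py 𝟘∈ = ⊥-elim (𝟘∉α 𝟘∈)
      δ-zero py px 𝟘∈ = ⊥-elim (𝟘∉α 𝟘∈)
      δ-zero py pz 𝟘∈ = ⊥-elim (𝟘∉β 𝟘∈)
      δ-zero pz py 𝟘∈ = ⊥-elim (𝟘∉β 𝟘∈)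
      δ-zero px pz 𝟘∈ = ⊥-elim (𝟘∉σ 𝟘∈)
      δ-zero pz px 𝟘∈ = ⊥-elim (𝟘∉σ 𝟘∈)

      δ-tri : ∀ a b c → δ a c ≤* δ a b ⊞ δ b c
      δ-tri px px c  = y≤*x⊞y 𝟘* (δ px c)
      δ-tri py py c  = y≤*x⊞y 𝟘* (δ py c)
      δ-tri pz pz c  = y≤*x⊞y 𝟘* (δ pz c)
      δ-tri px py py = x≤*x⊞y α 𝟘*
      δ-tri py px px = x≤*x⊞y α 𝟘*
      δ-tri py pz pz = x≤*x⊞y β 𝟘*
      δ-tri pz py py = x≤*x⊞y β 𝟘*
      δ-tri px pz pz = x≤*x⊞y σ 𝟘*
      δ-tri pz px px = x≤*x⊞y σ 𝟘*
      δ-tri px py px = 𝟘*-minimum (α ⊞ α)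
      δ-tri py px py = 𝟘*-minimum (α ⊞ α)
      δ-tri py pz py = 𝟘*-minimum (β ⊞ β)
      δ-tri pz py pz = 𝟘*-minimum (β ⊞ β)
      δ-tri px pz px = 𝟘*-minimum (σ ⊞ σ)
      δ-tri pz px pz = 𝟘*-minimum (σ ⊞ σ)
      δ-tri px py pz = ≤*-refl {σ}
      δ-tri pz py px = ⊞-comm α β
      δ-tri px pz py = ≤*-trans {α} {α ⊞ β} {σ ⊞ β} (x≤*x⊞y α β) (x≤*x⊞y σ β)
      δ-tri py pz px = ≤*-trans {α} {α ⊞ β} {β ⊞ σ} (x≤*x⊞y α β) (y≤*x⊞y β σ)
      δ-tri py px pz = ≤*-trans {β} {α ⊞ β} {α ⊞ σ} (y≤*x⊞y α β) (y≤*x⊞y α σ)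
      δ-tri pz px py = ≤*-trans {β} {α ⊞ β} {σ ⊞ α} (y≤*x⊞y α β) (x≤*x⊞y σ α)

  data Two : Set ℓ where
    pp pq : Two

  segment : (γ : Cut) → ¬ mem γ 0S → CutMetric Two
  segment γ 𝟘∉γ = record { δ = δ ; δ-sym = δ-sym ; δ-refl = δ-refl ; δ-zero = δ-zero ; δ-tri = δ-tri }
    where
      δ : Two → Two → Cut
      δ pp pp = 𝟘*
      δ pq pq = 𝟘*
      δ pp pq = γ
      δ pq pp = γ

      δ-sym : ∀ a b → δ b a ≤* δ a b
      δ-sym pp pp = ≤*-refl {𝟘*}
      δ-sym pq pq = ≤*-refl {𝟘*}
      δ-sym pp pq = ≤*-refl {γ}
      δ-sym pq pp = ≤*-refl {γ}

      δ-refl : ∀ a → mem (δ a a) 0S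
      δ-refl pp = ≤-refl
      δ-refl pq = ≤-refl

      δ-zero : ∀ a b → mem (δ a b) 0S → a ≡ b
      δ-zero pp pp _ = refl
      δ-zero pq pq _ = refl
      δ-zero pp pq 𝟘∈ = ⊥-elim (𝟘∉γ 𝟘∈)
      δ-zero pq pp 𝟘∈ = ⊥-elim (𝟘∉γ 𝟘∈)

      δ-tri : ∀ a b c → δ a c ≤* δ a b ⊞ δ b c
      δ-tri pp pp c  = y≤*x⊞y 𝟘* (δ pp c)
      δ-tri pq pq c  = y≤*x⊞y 𝟘* (δ pq c)
      δ-tri pp pq pq = x≤*x⊞y γ 𝟘*
      δ-tri pq pp pp = x≤*x⊞y γ 𝟘*
      δ-tri pp pq pp = 𝟘*-minimum (γ ⊞ γ)
      δ-tri pq pp pq = 𝟘*-minimum (γ ⊞ γ)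

  point : CutMetric ⊤
  point = record
    { δ      = λ _ _ → 𝟘*
    ; δ-sym  = λ _ _ → ≤*-refl {𝟘*}
    ; δ-refl = λ _ → ≤-refl
    ; δ-zero = λ _ _ _ → refl
    ; δ-tri  = λ _ _ _ → y≤*x⊞y 𝟘* 𝟘*
    }

  -- Points at distance 0 must be equal in a model, so they are merged whenever 0 ∈ α or 0 ∈ β.
  ⊞-consistent : ∀ α β → Consistent ≤-trans α β (α ⊞ β)
  ⊞-consistent α β with em {mem α 0S} | em {mem β 0S}
  ... | no 𝟘∉α | no 𝟘∉β =
    CutMetric.consistent (triangle α β 𝟘∉α 𝟘∉β) {α} {β} {α ⊞ β} px py pz
      (≈*-refl {α}) (≈*-refl {β}) (≈*-refl {α ⊞ β})
  ... | yes 𝟘∈α | no 𝟘∉β =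
    CutMetric.consistent (segment β 𝟘∉β) {α} {β} {α ⊞ β} pp pp pq (𝟘∈⇒≈𝟘* α 𝟘∈α) (≈*-refl {β})
      (y≤*x⊞y α β , ⊞-identityˡ α β 𝟘∈α)
  ... | no 𝟘∉α | yes 𝟘∈β =
    CutMetric.consistent (segment α 𝟘∉α) {α} {β} {α ⊞ β} pp pq pq (≈*-refl {α}) (𝟘∈⇒≈𝟘* β 𝟘∈β)
      (x≤*x⊞y α β , ⊞-identityʳ α β 𝟘∈β)
  ... | yes 𝟘∈α | yes 𝟘∈β =
    CutMetric.consistent point {α} {β} {α ⊞ β} _ _ _ (𝟘∈⇒≈𝟘* α 𝟘∈α) (𝟘∈⇒≈𝟘* β 𝟘∈β)
      (𝟘∈⇒≈𝟘* (α ⊞ β) (⊞-identityˡ α β 𝟘∈α 0S 𝟘∈β))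

  consistent⇒≤*⊞ : ∀ {α β γ} → Consistent ≤-trans α β γ → γ ≤* α ⊞ β
  consistent⇒≤*⊞ {α} {β} (_ , D , model , x , y , z , xy , yz , xz) t (r , s , r∈α , s∈β , empty) =
    dne λ t∉γ → proj₂ (xz t) (λ γ≤↑t → t∉γ (γ≤↑t t ≤-refl)) d[x,z]≤t
    where
      d[x,z]≤t : D x z t
      d[x,z]≤t = IsModel.triAx model r s t empty x y z
                   (proj₁ (xy r) (∈⇒≤*↑ α r∈α)) (proj₁ (yz s) (∈⇒≤*↑ β s∈β))

  ⊞-isOplus* : IsOplus* ≤-trans _⊞_
  ⊞-isOplus* α β = (λ γ → consistent⇒≤*⊞ {α} {β} {γ}) , λ τ ub → ub (α ⊞ β) (⊞-consistent α β)

  isSup*-unique : ∀ {U σ σ′} → IsSup* ≤-trans U σ → IsSup* ≤-trans U σ′ → σ ≈* σ′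
  isSup*-unique {σ = σ} {σ′} (ub , least) (ub′ , least′) = least σ′ ub′ , least′ σ ub

  ⊞-isDistanceMagma : IsDistanceMagma _≈*_ _≤*_ _⊞_ 𝟘*
  ⊞-isDistanceMagma = record
    { isTotalOrder = ≤*-isTotalOrder
    ; ⊕-cong       = λ {A} {A′} {B} {B′} (A≤A′ , A′≤A) (B≤B′ , B′≤B) →
                       ⊞-mono {A} {B} {A′} {B′} A≤A′ B≤B′ , ⊞-mono {A′} {B′} {A} {B} A′≤A B′≤B
    ; extensive    = x≤*x⊞y
    ; monotone     = λ {A} {B} {A′} {B′} → ⊞-mono {A} {B} {A′} {B′}
    ; comm         = λ A B → ⊞-comm A B , ⊞-comm B A
    ; identityˡ    = λ A → ⊞-identityˡ 𝟘* A ≤-refl , y≤*x⊞y 𝟘* A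
    ; identityʳ    = λ A → ⊞-identityʳ A 𝟘* ≤-refl , x≤*x⊞y A 𝟘*
    }

  Diff : Cut → Cut → Cut → Set ℓ
  Diff = DiffSet _≤*_ _⊞_

  Diff-upward : ∀ α β γ γ′ → γ ≤* γ′ → Diff α β γ → Diff α β γ′
  Diff-upward α β γ γ′ γ≤γ′ (α≤ , β≤) =
    ≤*-trans {α} {β ⊞ γ} {β ⊞ γ′} α≤ (⊞-mono {β} {γ} {β} {γ′} (≤*-refl {β}) γ≤γ′) ,
    ≤*-trans {β} {α ⊞ γ} {α ⊞ γ′} β≤ (⊞-mono {α} {γ} {α} {γ′} (≤*-refl {α}) γ≤γ′)

  infixl 30 _⊖_

  _⊖_ : Cut → Cut → Cut
  α ⊖ β = record
    { mem    = λ s → Diff α β (↑ s)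
    ; upward = λ s s′ s≤s′ → Diff-upward α β (↑ s) (↑ s′) (λ t s′≤t → ≤-trans s≤s′ s′≤t)
    ; hasMax = λ m isMax → ≤*⊞↑-max m isMax α β , ≤*⊞↑-max m isMax β α
    }

  ⊖-diff : ∀ α β → Diff α β (α ⊖ β)
  ⊖-diff α β =
    (λ t (r , s , r∈β , s∈α⊖β , empty) → proj₁ s∈α⊖β t (r , s , r∈β , ≤-refl , empty)) ,
    (λ t (r , s , r∈α , s∈α⊖β , empty) → proj₂ s∈α⊖β t (r , s , r∈α , ≤-refl , empty))

  ⊖-minimal : ∀ α β γ → Diff α β γ → α ⊖ β ≤* γ
  ⊖-minimal α β γ γ∈Diff s s∈γ = Diff-upward α β γ (↑ s) (∈⇒≤*↑ γ s∈γ) γ∈Diff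

  ⊞-isDifferenceCompleteDistanceMagma : IsDifferenceCompleteDistanceMagma _≈*_ _≤*_ _⊞_ 𝟘*
  ⊞-isDifferenceCompleteDistanceMagma = record
    { isDistanceMagma = ⊞-isDistanceMagma
    ; diffMin         = λ α β → α ⊖ β , ⊖-diff α β , ⊖-minimal α β
    }

  isOplus*⇒isDifferenceCompleteDistanceMagma :
    ∀ op → IsOplus* ≤-trans op → IsDifferenceCompleteDistanceMagma _≈*_ _≤*_ op 𝟘*
  isOplus*⇒isDifferenceCompleteDistanceMagma op isOp =
    isDifferenceCompleteDistanceMagma-resp
      (λ α β → isSup*-unique {σ = α ⊞ β} {op α β} (⊞-isOplus* α β) (isOp α β))
      ⊞-isDifferenceCompleteDistanceMagma

theorem4p11 : ∀ {ℓ} → ExcludedMiddle (lsuc ℓ) →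
    (R : Set ℓ) (_⊕_ : R → R → R) (_≤_ : Rel R ℓ) (𝟘 : R) →
    (isDM : IsDistanceMagma _≡_ _≤_ _⊕_ 𝟘) →
    (S : Pred R ℓ) (𝟘∈S : S 𝟘) →
    let open Construction R _⊕_ _≤_ 𝟘 S 𝟘∈S
        trans = IsDistanceMagma.isTotalOrder isDM
    in (Σ[ op ∈ (Cut → Cut → Cut) ] IsOplus* (IsTotalOrderTrans trans) op)
       × (∀ op → IsOplus* (IsTotalOrderTrans trans) op →
            IsDifferenceCompleteDistanceMagma _≈*_ _≤*_ op (0* (IsTotalOrderTrans trans)))
theorem4p11 lem R _⊕_ _≤_ 𝟘 isDM S 𝟘∈S =
  (_⊞_ , ⊞-isOplus*) , isOplus*⇒isDifferenceCompleteDistanceMagma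
  where open CutMagma (lower-em lem) R _⊕_ _≤_ 𝟘 isDM S 𝟘∈S
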